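{- Let $\theta$ be a positive integer and let $C$ be a regular conference matrix of size $4\theta^2+4\theta+2$. Let $x=\dfrac{ -1\pm\sqrt{4\theta^2(\theta+1)^2-1}\ i}{2\theta(\theta+1)}$ (either choice of sign). Let $W$ be the matrix obtained from $C$ by replacing each entry $0$ by $1$, each entry $1$ by $x$, and each entry $-1$ by $\overline{x}$. Then $W$ is a complex Hadamard matrix.
   Context: A conference matrix of size $n$ is an $n\times n$ matrix $C$ with zero diagonal and off-diagonal entries in $\{1,-1\}$ satisfying $CC^T=(n-1)I$; it is regular if all its row sums are equal. An $n\times n$ complex matrix $W$ is a complex Hadamard matrix if every entry has absolute value $1$ and $W\overline{W}^T=nI$. -}

module Defs where

open import Data.Nat as ℕ using (ℕ; zero; suc)
open import Data.Integer as ℤ using (ℤ; +_; -[1+_])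
open import Data.Rational as ℚ using (ℚ; _/_)
open import Data.Fin using (Fin; zero; suc)
open import Data.Bool using (Bool; true; false)
open import Data.Product using (_×_; ∃-syntax)
open import Data.Sum using (_⊎_)
open import Relation.Binary.PropositionalEquality using (_≡_; _≢_)

sumℤ : ∀ {n} → (Fin n → ℤ) → ℤ
sumℤ {zero}  f = + 0
sumℤ {suc n} f = f zero ℤ.+ sumℤ (λ k → f (suc k))

IsConference : (n : ℕ) → (Fin n → Fin n → ℤ) → Set
IsConference n C =
    (∀ i → C i i ≡ + 0)
  × (∀ i j → i ≢ j → (C i j ≡ + 1 ⊎ C i j ≡ ℤ.- (+ 1)))
  × (∀ i → sumℤ (λ k → C i k ℤ.* C i k) ≡ + (n ℕ.∸ 1))
  × (∀ i j → i ≢ j → sumℤ (λ k → C i k ℤ.* C j k) ≡ + 0)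

IsRegularConference : (n : ℕ) → (Fin n → Fin n → ℤ) → Set
IsRegularConference n C =
  IsConference n C × ∃[ r ] (∀ i → sumℤ (C i) ≡ r)

-- The field ℚ(√(-D)) ⊆ ℂ: the pair (a , b) represents a + b·i·√D,
-- for a fixed rational D > 0.  Complex conjugation is (a , b) ↦ (a , -b).

record Ext : Set where
  constructor ⟨_,_⟩
  field
    re : ℚ
    im : ℚ

open Ext public

0ₑ 1ₑ : Ext
0ₑ = ⟨ ℚ.0ℚ , ℚ.0ℚ ⟩
1ₑ = ⟨ ℚ.1ℚ , ℚ.0ℚ ⟩

fromℕₑ : ℕ → Ext
fromℕₑ n = ⟨ + n / 1 , ℚ.0ℚ ⟩

_+ₑ_ : Ext → Ext → Ext
⟨ a , b ⟩ +ₑ ⟨ c , d ⟩ = ⟨ a ℚ.+ c , b ℚ.+ d ⟩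

-- multiplication in ℚ(√(-D)), using (i√D)² = -D
mulₑ : ℚ → Ext → Ext → Ext
mulₑ D ⟨ a , b ⟩ ⟨ c , d ⟩ = ⟨ a ℚ.* c ℚ.- D ℚ.* (b ℚ.* d) , a ℚ.* d ℚ.+ b ℚ.* c ⟩

conjₑ : Ext → Ext
conjₑ ⟨ a , b ⟩ = ⟨ a , ℚ.- b ⟩

sumₑ : ∀ {n} → (Fin n → Ext) → Ext
sumₑ {zero}  f = 0ₑ
sumₑ {suc n} f = f zero +ₑ sumₑ (λ k → f (suc k))

IsComplexHadamard : ℚ → (n : ℕ) → (Fin n → Fin n → Ext) → Set
IsComplexHadamard D n W =
    (∀ i j → mulₑ D (W i j) (conjₑ (W i j)) ≡ 1ₑ)
  × (∀ i → sumₑ (λ k → mulₑ D (W i k) (conjₑ (W i k))) ≡ fromℕₑ n)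
  × (∀ i j → i ≢ j → sumₑ (λ k → mulₑ D (W i k) (conjₑ (W j k))) ≡ 0ₑ)

confSize : ℕ → ℕ
confSize θ = 4 ℕ.* θ ℕ.* θ ℕ.+ 4 ℕ.* θ ℕ.+ 2

-- D = 4θ²(θ+1)² - 1, so that x = (-1 ± √D i) / (2θ(θ+1))
Dθ : ℕ → ℚ
Dθ θ = + (4 ℕ.* θ ℕ.* θ ℕ.* (θ ℕ.+ 1) ℕ.* (θ ℕ.+ 1) ℕ.∸ 1) / 1

-- x = (-1 ± √D i)/(2θ(θ+1)); the Bool selects the sign (true = +).
-- Only meaningful for θ > 0 (the θ = 0 clause is a junk value never used).
xθ : ℕ → Bool → Ext
xθ zero    _     = 0ₑ
xθ (suc k) true  = ⟨ -[1+ 0 ] / (2 ℕ.* suc k ℕ.* suc (suc k)) , + 1 / (2 ℕ.* suc k ℕ.* suc (suc k)) ⟩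
xθ (suc k) false = ⟨ -[1+ 0 ] / (2 ℕ.* suc k ℕ.* suc (suc k)) , -[1+ 0 ] / (2 ℕ.* suc k ℕ.* suc (suc k)) ⟩

-- entry replacement: 0 ↦ 1, 1 ↦ x, -1 ↦ x̄ (other values never occur
-- in a conference matrix; they are sent to 0 arbitrarily)
replace : Ext → ℤ → Ext
replace x (+ 0)       = 1ₑ
replace x (+ 1)       = x
replace x -[1+ 0 ]    = conjₑ x
replace x _           = 0ₑ

module Submission where

open import Defs
open import Data.Nat using (ℕ; _<_)
open import Data.Integer using (ℤ)
open import Data.Fin using (Fin)
open import Data.Bool using (Bool)

open import Level using (0ℓ)
open import Algebra.Bundles using (CommutativeMonoid; CommutativeRing; Semiring)
import Algebra.Properties.CommutativeMonoid.Sum as MonoidSum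
import Algebra.Properties.Semiring.Sum as SemiringSum
import Algebra.Solver.CommutativeMonoid as CommutativeMonoidSolver
open import Algebra.Structures.Biased using (isCommutativeMonoidˡ)
open import Data.Bool using (true; false)
open import Data.Fin using (zero; suc; _≟_)
open import Data.Fin.Properties using (suc-injective)
open import Data.List using (_∷_; [])
import Data.Nat as ℕ
import Data.Nat.Properties as ℕP
open import Data.Nat.Tactic.RingSolver using (solve-∀)
import Data.Integer as ℤ
open import Data.Integer using (+_; -[1+_])
import Data.Integer.Properties as ℤP
open import Data.Integer.Divisibility.Signed using (_∣_; divides; ∣⇒∣ᵤ)
open import Data.Integer.Tactic.RingSolver using () renaming (ring to ℤ-ring)
import Data.Nat.Divisibility as ℕ∣
open import Data.Product using (_×_; _,_; proj₁; proj₂)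
import Data.Rational as ℚ
open import Data.Rational using (ℚ; _/_; 0ℚ; 1ℚ)
import Data.Rational.Properties as ℚP
open import Algebra.Properties.Group ℚP.+-0-group using (∙-cancelʳ)
open import Data.Rational.Unnormalised using (mkℚᵘ; *≡*)
import Data.Rational.Unnormalised as ℚᵘ
import Data.Rational.Unnormalised.Properties as ℚᵘP
open import Data.Sum using (_⊎_; inj₁; inj₂)
open import Relation.Binary.PropositionalEquality as ≡
  using (_≡_; _≢_; refl; sym; trans; cong; cong₂; module ≡-Reasoning)
open import Relation.Nullary using (¬_; yes; no; contradiction)
open import Relation.Nullary.Decidable using (dec⇒maybe)
open import Tactic.RingSolver using (solve)
open import Tactic.RingSolver.Core.AlmostCommutativeRing
  using (AlmostCommutativeRing; fromCommutativeRing)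

-- Corollary 2.6.  Put w(0) = 1, w(1) = x, w(−1) = x̄ and x = a + b·i√D; the
-- diagonal of W·W̄ᵀ = nI only needs |x| = 1.  For distinct rows u = C i and
-- v = C j of C:
--  (1) C i j = C j i, since n ≡ 2 (mod 4): H(u,v) = (u − v)(u − v − 2) is
--      ≡ 0 (mod 8) on pairs of signs while Σₖ H(uₖ,vₖ) = 2(n − 1), and this
--      pins down the two exceptional positions k = i, j modulo 8;
--  (2) on pairs of signs w(ε)·conj w(δ) = a² + Db²εδ + i√D·ab(ε − δ), so off
--      k = i, j the inner product only involves Σ uₖvₖ = 0 and Σ uₖ = Σ vₖ,
--      while by (1) the exceptional terms give x̄ + x = 2a; the inner
--      product is n a² + 2a − 2a², with vanishing imaginary part.
-- Both steps compare two sums whose terms agree off two indices.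

module SumsAgreeingOffTwoIndices {c ℓ} (M : CommutativeMonoid c ℓ) where

  open CommutativeMonoid M renaming
    (_∙_ to _+_; ∙-cong to +-cong; ∙-congˡ to +-congˡ; comm to +-comm;
     refl to ≈-refl; sym to ≈-sym)
  open MonoidSum M using (sum; sum-cong-≋)
  module CM = CommutativeMonoidSolver M
  open CM using (_⊕_; _⊜_)
  open import Relation.Binary.Reasoning.Setoid setoid

  -- If two families agree away from the index j, their sums differ by the
  -- two terms at j (stated additively, so no subtraction is needed).
  sum-agree-off-one : ∀ {n} (f g : Fin n → Carrier) (j : Fin n) →
    (∀ k → k ≢ j → f k ≈ g k) → sum f + g j ≈ sum g + f j
  sum-agree-off-one f g zero agree = begin
    (f zero + sum (λ k → f (suc k))) + g zero ≈⟨ rotate (f zero) _ (g zero) ⟩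
    g zero + (sum (λ k → f (suc k)) + f zero)
      ≈⟨ +-congˡ (+-cong (sum-cong-≋ λ k → agree (suc k) λ ()) ≈-refl) ⟩
    g zero + (sum (λ k → g (suc k)) + f zero) ≈⟨ ≈-sym (assoc _ _ _) ⟩
    (g zero + sum (λ k → g (suc k))) + f zero ∎
    where
    rotate : ∀ a s b → (a + s) + b ≈ b + (s + a)
    rotate = CM.solve 3 (λ a s b → (a ⊕ s) ⊕ b ⊜ b ⊕ (s ⊕ a)) ≈-refl
  sum-agree-off-one f g (suc j) agree = begin
    (f zero + sum (λ k → f (suc k))) + g (suc j) ≈⟨ assoc _ _ _ ⟩
    f zero + (sum (λ k → f (suc k)) + g (suc j))
      ≈⟨ +-cong (agree zero λ ())
                (sum-agree-off-one (λ k → f (suc k)) (λ k → g (suc k)) j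
                  λ k k≢j → agree (suc k) λ e → k≢j (suc-injective e)) ⟩
    g zero + (sum (λ k → g (suc k)) + f (suc j)) ≈⟨ ≈-sym (assoc _ _ _) ⟩
    (g zero + sum (λ k → g (suc k))) + f (suc j) ∎

  sum-agree-off-two : ∀ {n} (f g : Fin n → Carrier) (i j : Fin n) → i ≢ j →
    (∀ k → k ≢ i → k ≢ j → f k ≈ g k) → sum f + (g i + g j) ≈ sum g + (f i + f j)
  sum-agree-off-two f g zero zero i≢j _ = contradiction refl i≢j
  sum-agree-off-two f g zero (suc j) _ agree = begin
    (f zero + sum (λ k → f (suc k))) + (g zero + g (suc j))
      ≈⟨ regroup (f zero) _ (g zero) _ ⟩
    f zero + (g zero + (sum (λ k → f (suc k)) + g (suc j)))
      ≈⟨ +-congˡ (+-congˡ (sum-agree-off-one (λ k → f (suc k)) (λ k → g (suc k)) j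
                   λ k k≢j → agree (suc k) (λ ()) λ e → k≢j (suc-injective e))) ⟩
    f zero + (g zero + (sum (λ k → g (suc k)) + f (suc j)))
      ≈⟨ ungroup (f zero) (g zero) _ _ ⟩
    (g zero + sum (λ k → g (suc k))) + (f zero + f (suc j)) ∎
    where
    regroup : ∀ a s b t → (a + s) + (b + t) ≈ a + (b + (s + t))
    regroup = CM.solve 4 (λ a s b t → (a ⊕ s) ⊕ (b ⊕ t) ⊜ a ⊕ (b ⊕ (s ⊕ t))) ≈-refl
    ungroup : ∀ a b s t → a + (b + (s + t)) ≈ (b + s) + (a + t)
    ungroup = CM.solve 4 (λ a b s t → a ⊕ (b ⊕ (s ⊕ t)) ⊜ (b ⊕ s) ⊕ (a ⊕ t)) ≈-refl
  sum-agree-off-two f g (suc i) zero i≢j agree = begin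
    sum f + (g (suc i) + g zero) ≈⟨ +-congˡ (+-comm _ _) ⟩
    sum f + (g zero + g (suc i))
      ≈⟨ sum-agree-off-two f g zero (suc i) (λ e → i≢j (sym e))
           (λ k k≢0 k≢si → agree k k≢si k≢0) ⟩
    sum g + (f zero + f (suc i)) ≈⟨ +-congˡ (+-comm _ _) ⟩
    sum g + (f (suc i) + f zero) ∎
  sum-agree-off-two f g (suc i) (suc j) i≢j agree = begin
    (f zero + sum (λ k → f (suc k))) + (g (suc i) + g (suc j)) ≈⟨ assoc _ _ _ ⟩
    f zero + (sum (λ k → f (suc k)) + (g (suc i) + g (suc j)))
      ≈⟨ +-cong (agree zero (λ ()) (λ ()))
           (sum-agree-off-two (λ k → f (suc k)) (λ k → g (suc k)) i j
             (λ e → i≢j (cong suc e))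
             λ k k≢i k≢j → agree (suc k) (λ e → k≢i (suc-injective e))
                                         (λ e → k≢j (suc-injective e))) ⟩
    g zero + (sum (λ k → g (suc k)) + (f (suc i) + f (suc j))) ≈⟨ ≈-sym (assoc _ _ _) ⟩
    (g zero + sum (λ k → g (suc k))) + (f (suc i) + f (suc j)) ∎

module Σℤ = SemiringSum ℤP.+-*-semiring
module Σℚ = SemiringSum (CommutativeRing.semiring ℚP.+-*-commutativeRing)

sumℤ≡sum : ∀ {n} (f : Fin n → ℤ) → sumℤ f ≡ Σℤ.sum f
sumℤ≡sum {ℕ.zero}  f = refl
sumℤ≡sum {ℕ.suc n} f = cong (λ s → f zero ℤ.+ s) (sumℤ≡sum (λ k → f (suc k)))

ℚ-ring : AlmostCommutativeRing 0ℓ 0ℓ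
ℚ-ring = fromCommutativeRing ℚP.+-*-commutativeRing (λ p → dec⇒maybe (0ℚ ℚ.≟ p))

ι : ℤ → ℚ
ι z = z / 1

toℚᵘ-ι : ∀ a → ℚ.toℚᵘ (ι a) ℚᵘ.≃ mkℚᵘ a 0
toℚᵘ-ι a = ℚP.toℚᵘ-fromℚᵘ (mkℚᵘ a 0)

ι-+ : ∀ a b → ι (a ℤ.+ b) ≡ ι a ℚ.+ ι b
ι-+ a b = ℚP.toℚᵘ-injective (begin
  ℚ.toℚᵘ (ι (a ℤ.+ b))            ≈⟨ toℚᵘ-ι (a ℤ.+ b) ⟩
  mkℚᵘ (a ℤ.+ b) 0                 ≈⟨ *≡* cross-multiplied ⟩
  mkℚᵘ a 0 ℚᵘ.+ mkℚᵘ b 0           ≈⟨ ℚᵘP.+-cong (toℚᵘ-ι a) (toℚᵘ-ι b) ⟨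
  ℚ.toℚᵘ (ι a) ℚᵘ.+ ℚ.toℚᵘ (ι b)   ≈⟨ ℚP.toℚᵘ-homo-+ (ι a) (ι b) ⟨
  ℚ.toℚᵘ (ι a ℚ.+ ι b)             ∎)
  where
  open ℚᵘP.≃-Reasoning
  cross-multiplied : (a ℤ.+ b) ℤ.* + 1 ≡ (a ℤ.* + 1 ℤ.+ b ℤ.* + 1) ℤ.* + 1
  cross-multiplied = solve (a ∷ b ∷ []) ℤ-ring

ι-* : ∀ a b → ι (a ℤ.* b) ≡ ι a ℚ.* ι b
ι-* a b = ℚP.toℚᵘ-injective (begin
  ℚ.toℚᵘ (ι (a ℤ.* b))            ≈⟨ toℚᵘ-ι (a ℤ.* b) ⟩
  mkℚᵘ (a ℤ.* b) 0                 ≈⟨ *≡* refl ⟩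
  mkℚᵘ a 0 ℚᵘ.* mkℚᵘ b 0           ≈⟨ ℚᵘP.*-cong (toℚᵘ-ι a) (toℚᵘ-ι b) ⟨
  ℚ.toℚᵘ (ι a) ℚᵘ.* ℚ.toℚᵘ (ι b)   ≈⟨ ℚP.toℚᵘ-homo-* (ι a) (ι b) ⟨
  ℚ.toℚᵘ (ι a ℚ.* ι b)             ∎)
  where open ℚᵘP.≃-Reasoning

ι-inverse : ∀ m → ι (+ ℕ.suc m) ℚ.* (+ 1 / ℕ.suc m) ≡ 1ℚ
ι-inverse m = ℚP.toℚᵘ-injective (begin
  ℚ.toℚᵘ (ι (+ ℕ.suc m) ℚ.* (+ 1 / ℕ.suc m))
    ≈⟨ ℚP.toℚᵘ-homo-* (ι (+ ℕ.suc m)) (+ 1 / ℕ.suc m) ⟩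
  ℚ.toℚᵘ (ι (+ ℕ.suc m)) ℚᵘ.* ℚ.toℚᵘ (+ 1 / ℕ.suc m)
    ≈⟨ ℚᵘP.*-cong (toℚᵘ-ι (+ ℕ.suc m)) (ℚP.toℚᵘ-fromℚᵘ (mkℚᵘ (+ 1) m)) ⟩
  mkℚᵘ (+ ℕ.suc m) 0 ℚᵘ.* mkℚᵘ (+ 1) m
    ≈⟨ *≡* (cross-multiplied (+ ℕ.suc m)) ⟩
  ℚ.toℚᵘ 1ℚ ∎)
  where
  open ℚᵘP.≃-Reasoning
  cross-multiplied : ∀ z → (z ℤ.* + 1) ℤ.* + 1 ≡ + 1 ℤ.* (+ 1 ℤ.* z)
  cross-multiplied z = solve (z ∷ []) ℤ-ring

ι-sum : ∀ {n} (f : Fin n → ℤ) → Σℚ.sum (λ k → ι (f k)) ≡ ι (Σℤ.sum f)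
ι-sum {ℕ.zero}  f = refl
ι-sum {ℕ.suc n} f = trans (cong (ι (f zero) ℚ.+_) (ι-sum (λ k → f (suc k))))
                          (sym (ι-+ (f zero) (Σℤ.sum (λ k → f (suc k)))))

+ₑ-commutativeMonoid : CommutativeMonoid 0ℓ 0ℓ
+ₑ-commutativeMonoid = record
  { Carrier = Ext ; _≈_ = _≡_ ; _∙_ = _+ₑ_ ; ε = 0ₑ
  ; isCommutativeMonoid = isCommutativeMonoidˡ record
    { isSemigroup = record
      { isMagma = record { isEquivalence = ≡.isEquivalence ; ∙-cong = cong₂ _+ₑ_ }
      ; assoc   = λ p q r → cong₂ ⟨_,_⟩ (ℚP.+-assoc (re p) (re q) (re r))
                                        (ℚP.+-assoc (im p) (im q) (im r)) }
    ; identityˡ = λ p → cong₂ ⟨_,_⟩ (ℚP.+-identityˡ (re p)) (ℚP.+-identityˡ (im p))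
    ; comm      = λ p q → cong₂ ⟨_,_⟩ (ℚP.+-comm (re p) (re q)) (ℚP.+-comm (im p) (im q)) } }

module Σₑ = MonoidSum +ₑ-commutativeMonoid

sumₑ≡sum : ∀ {n} (f : Fin n → Ext) → sumₑ f ≡ Σₑ.sum f
sumₑ≡sum {ℕ.zero}  f = refl
sumₑ≡sum {ℕ.suc n} f = cong (f zero +ₑ_) (sumₑ≡sum (λ k → f (suc k)))

sum-components : ∀ {n} (f : Fin n → Ext) →
  Σₑ.sum f ≡ ⟨ Σℚ.sum (λ k → re (f k)) , Σℚ.sum (λ k → im (f k)) ⟩
sum-components {ℕ.zero}  f = refl
sum-components {ℕ.suc n} f = cong (f zero +ₑ_) (sum-components (λ k → f (suc k)))

+ₑ-cancelʳ : ∀ p q r → p +ₑ r ≡ q +ₑ r → p ≡ q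
+ₑ-cancelʳ p q r eq = cong₂ ⟨_,_⟩ (∙-cancelʳ (re r) (re p) (re q) (cong re eq))
                                  (∙-cancelʳ (im r) (im p) (im q) (cong im eq))

sumₑ-ones : ∀ {n} (f : Fin n → Ext) → (∀ k → f k ≡ 1ₑ) → sumₑ f ≡ fromℕₑ n
sumₑ-ones {ℕ.zero}  f ones = refl
sumₑ-ones {ℕ.suc n} f ones = begin
  f zero +ₑ sumₑ (λ k → f (suc k)) ≡⟨ cong₂ _+ₑ_ (ones zero) (sumₑ-ones _ (λ k → ones (suc k))) ⟩
  1ₑ +ₑ fromℕₑ n                   ≡⟨ cong (⟨_, 0ℚ ⟩) (sym (ι-+ (+ 1) (+ n))) ⟩
  fromℕₑ (ℕ.suc n)                  ∎
  where open ≡-Reasoning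

IsSign : ℤ → Set
IsSign z = z ≡ + 1 ⊎ z ≡ -[1+ 0 ]

record RowPair {n} (u v : Fin n → ℤ) (i j : Fin n) : Set where
  field
    distinct   : i ≢ j
    u-diagonal : u i ≡ + 0
    v-diagonal : v j ≡ + 0
    u-sign     : ∀ k → k ≢ i → IsSign (u k)
    v-sign     : ∀ k → k ≢ j → IsSign (v k)
    u-norm     : Σℤ.sum (λ k → u k ℤ.* u k) ≡ + (n ℕ.∸ 1)
    v-norm     : Σℤ.sum (λ k → v k ℤ.* v k) ≡ + (n ℕ.∸ 1)
    orthogonal : Σℤ.sum (λ k → u k ℤ.* v k) ≡ + 0
    rowSum     : ℤ
    u-sum      : Σℤ.sum u ≡ rowSum
    v-sum      : Σℤ.sum v ≡ rowSum

  signs-off : ∀ k → k ≢ i → k ≢ j → IsSign (u k) × IsSign (v k)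
  signs-off k k≢i k≢j = u-sign k k≢i , v-sign k k≢j

rowPair : ∀ {n} {C : Fin n → Fin n → ℤ} → IsRegularConference n C →
  ∀ {i j} → i ≢ j → RowPair (C i) (C j) i j
rowPair {C = C} ((diag , sign , norm , orth) , r , rowsum) {i} {j} i≢j = record
  { distinct   = i≢j
  ; u-diagonal = diag i
  ; v-diagonal = diag j
  ; u-sign     = λ k k≢i → sign i k (λ e → k≢i (sym e))
  ; v-sign     = λ k k≢j → sign j k (λ e → k≢j (sym e))
  ; u-norm     = trans (sym (sumℤ≡sum (λ k → C i k ℤ.* C i k))) (norm i)
  ; v-norm     = trans (sym (sumℤ≡sum (λ k → C j k ℤ.* C j k))) (norm j)
  ; orthogonal = trans (sym (sumℤ≡sum (λ k → C i k ℤ.* C j k))) (orth i j i≢j)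
  ; rowSum     = r
  ; u-sum      = trans (sym (sumℤ≡sum (C i))) (rowsum i)
  ; v-sum      = trans (sym (sumℤ≡sum (C j))) (rowsum j)
  }

-- H(u,v) = (u − v)(u − v − 2), expanded so that its sum along two rows can
-- be read off from the row relations.
H : ℤ → ℤ → ℤ
H u v = (u ℤ.* u ℤ.+ v ℤ.* v) ℤ.+ (-[1+ 1 ] ℤ.* (u ℤ.* v) ℤ.+ (-[1+ 1 ] ℤ.* u ℤ.+ + 2 ℤ.* v))

discord : ℤ → ℤ → ℤ
discord -[1+ 0 ] (+ 1) = + 1
discord _        _     = + 0

H-on-signs : ∀ {u v} → IsSign u → IsSign v → H u v ≡ + 8 ℤ.* discord u v
H-on-signs (inj₁ refl) (inj₁ refl) = refl
H-on-signs (inj₁ refl) (inj₂ refl) = refl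
H-on-signs (inj₂ refl) (inj₁ refl) = refl
H-on-signs (inj₂ refl) (inj₂ refl) = refl

sum-H : ∀ {n} {u v : Fin n → ℤ} {i j} → RowPair u v i j →
  Σℤ.sum (λ k → H (u k) (v k)) ≡ + (n ℕ.∸ 1) ℤ.+ + (n ℕ.∸ 1)
sum-H {n} {u} {v} rows = begin
  Σℤ.sum (λ k → H (u k) (v k))
    ≡⟨ Σℤ.∑-distrib-+ (λ k → uu k ℤ.+ vv k) (λ k → -[1+ 1 ] ℤ.* uv k ℤ.+ (-[1+ 1 ] ℤ.* u k ℤ.+ + 2 ℤ.* v k)) ⟩
  Σℤ.sum (λ k → uu k ℤ.+ vv k) ℤ.+ Σℤ.sum (λ k → -[1+ 1 ] ℤ.* uv k ℤ.+ (-[1+ 1 ] ℤ.* u k ℤ.+ + 2 ℤ.* v k))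
    ≡⟨ cong₂ ℤ._+_ (Σℤ.∑-distrib-+ uu vv)
         (trans (Σℤ.∑-distrib-+ (λ k → -[1+ 1 ] ℤ.* uv k) (λ k → -[1+ 1 ] ℤ.* u k ℤ.+ + 2 ℤ.* v k))
           (cong₂ ℤ._+_ (scale -[1+ 1 ] uv)
             (trans (Σℤ.∑-distrib-+ (λ k → -[1+ 1 ] ℤ.* u k) (λ k → + 2 ℤ.* v k))
               (cong₂ ℤ._+_ (scale -[1+ 1 ] u) (scale (+ 2) v))))) ⟩
  (Σℤ.sum uu ℤ.+ Σℤ.sum vv) ℤ.+ (-[1+ 1 ] ℤ.* Σℤ.sum uv ℤ.+ (-[1+ 1 ] ℤ.* Σℤ.sum u ℤ.+ + 2 ℤ.* Σℤ.sum v))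
    ≡⟨ cong₂ ℤ._+_ (cong₂ ℤ._+_ u-norm v-norm)
         (cong₂ ℤ._+_ (cong (-[1+ 1 ] ℤ.*_) orthogonal)
           (cong₂ ℤ._+_ (cong (-[1+ 1 ] ℤ.*_) u-sum) (cong (+ 2 ℤ.*_) v-sum))) ⟩
  (N ℤ.+ N) ℤ.+ (-[1+ 1 ] ℤ.* + 0 ℤ.+ (-[1+ 1 ] ℤ.* rowSum ℤ.+ + 2 ℤ.* rowSum))
    ≡⟨ linear-terms-cancel N rowSum ⟩
  N ℤ.+ N ∎
  where
  open ≡-Reasoning
  open RowPair rows
  N : ℤ
  N = + (n ℕ.∸ 1)
  uu vv uv : Fin n → ℤ
  uu k = u k ℤ.* u k
  vv k = v k ℤ.* v k
  uv k = u k ℤ.* v k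
  scale : ∀ c (f : Fin n → ℤ) → Σℤ.sum (λ k → c ℤ.* f k) ≡ c ℤ.* Σℤ.sum f
  scale c f = sym (Σℤ.*-distribˡ-sum c f)
  linear-terms-cancel : ∀ m r →
    (m ℤ.+ m) ℤ.+ (-[1+ 1 ] ℤ.* + 0 ℤ.+ (-[1+ 1 ] ℤ.* r ℤ.+ + 2 ℤ.* r)) ≡ m ℤ.+ m
  linear-terms-cancel m r = solve (m ∷ r ∷ []) ℤ-ring

mod8-balance : ∀ N P S G X → N ≡ + 4 ℤ.* P ℤ.+ + 1 →
  (N ℤ.+ N) ℤ.+ G ≡ + 8 ℤ.* S ℤ.+ X → + 8 ∣ X ℤ.- (G ℤ.+ + 2)
mod8-balance N P S G X N≡ balance = divides (P ℤ.- S) (begin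
  X ℤ.- (G ℤ.+ + 2)                                 ≡⟨ solve (X ∷ S ∷ G ∷ []) ℤ-ring ⟩
  ((+ 8 ℤ.* S ℤ.+ X) ℤ.- + 8 ℤ.* S) ℤ.- (G ℤ.+ + 2) ≡⟨ cong (λ t → (t ℤ.- + 8 ℤ.* S) ℤ.- (G ℤ.+ + 2)) (sym balance) ⟩
  (((N ℤ.+ N) ℤ.+ G) ℤ.- + 8 ℤ.* S) ℤ.- (G ℤ.+ + 2) ≡⟨ cong (λ t → (((t ℤ.+ t) ℤ.+ G) ℤ.- + 8 ℤ.* S) ℤ.- (G ℤ.+ + 2)) N≡ ⟩
  ((((+ 4 ℤ.* P ℤ.+ + 1) ℤ.+ (+ 4 ℤ.* P ℤ.+ + 1)) ℤ.+ G) ℤ.- + 8 ℤ.* S) ℤ.- (G ℤ.+ + 2)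
                                                    ≡⟨ solve (P ∷ S ∷ G ∷ []) ℤ-ring ⟩
  (P ℤ.- S) ℤ.* + 8 ∎)
  where open ≡-Reasoning

8∤4 : ¬ (8 ℕ∣.∣ 4)
8∤4 (ℕ∣.divides (ℕ.suc q) ())

-- At the exceptional positions (0, δ) and (ε, 0) of two rows, the excess of
-- H over 8·discord is ≡ 2 (mod 8) only if ε = δ: otherwise it is −2 or 6.
exceptional-agree : ∀ {ε δ} → IsSign ε → IsSign δ →
  + 8 ∣ (H (+ 0) δ ℤ.+ H ε (+ 0)) ℤ.-
        ((+ 8 ℤ.* discord (+ 0) δ ℤ.+ + 8 ℤ.* discord ε (+ 0)) ℤ.+ + 2) →
  ε ≡ δ
exceptional-agree (inj₁ refl) (inj₁ refl) _   = refl
exceptional-agree (inj₂ refl) (inj₂ refl) _   = refl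
exceptional-agree (inj₁ refl) (inj₂ refl) 8∣-4 = contradiction (∣⇒∣ᵤ 8∣-4) 8∤4
exceptional-agree (inj₂ refl) (inj₁ refl) 8∣4  = contradiction (∣⇒∣ᵤ 8∣4) 8∤4

module ℤ-agree = SumsAgreeingOffTwoIndices (Semiring.+-commutativeMonoid ℤP.+-*-semiring)
module Ext-agree = SumsAgreeingOffTwoIndices +ₑ-commutativeMonoid

-- Comparing Σ H with Σ 8·discord,
-- which agree off the positions i and j, gives 2(n − 1) + G = 8S + X.
rowPair-symmetric : ∀ {n} {u v : Fin n → ℤ} {i j} (P : ℕ) → RowPair u v i j →
  n ℕ.∸ 1 ≡ 4 ℕ.* P ℕ.+ 1 → u j ≡ v i
rowPair-symmetric {n} {u} {v} {i} {j} P rows n∸1≡ =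
  exceptional-agree (u-sign j (λ e → distinct (sym e))) (v-sign i distinct)
    (≡.subst₂ (λ p q → + 8 ∣ (H p (v i) ℤ.+ H (u j) q) ℤ.-
                              ((model p (v i) ℤ.+ model (u j) q) ℤ.+ + 2))
              u-diagonal v-diagonal
              (mod8-balance N (+ P) S (model (u i) (v i) ℤ.+ model (u j) (v j))
                            (H (u i) (v i) ℤ.+ H (u j) (v j)) N≡ balance))
  where
  open RowPair rows
  open ≡-Reasoning
  model : ℤ → ℤ → ℤ
  model p q = + 8 ℤ.* discord p q
  N S : ℤ
  N = + (n ℕ.∸ 1)
  S = Σℤ.sum (λ k → discord (u k) (v k))
  N≡ : N ≡ + 4 ℤ.* + P ℤ.+ + 1
  N≡ = trans (cong +_ n∸1≡) (cong (ℤ._+ + 1) (ℤP.pos-* 4 P))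
  balance : (N ℤ.+ N) ℤ.+ (model (u i) (v i) ℤ.+ model (u j) (v j))
          ≡ + 8 ℤ.* S ℤ.+ (H (u i) (v i) ℤ.+ H (u j) (v j))
  balance = begin
    (N ℤ.+ N) ℤ.+ (model (u i) (v i) ℤ.+ model (u j) (v j))
      ≡⟨ cong (ℤ._+ (model (u i) (v i) ℤ.+ model (u j) (v j))) (sym (sum-H rows)) ⟩
    Σℤ.sum (λ k → H (u k) (v k)) ℤ.+ (model (u i) (v i) ℤ.+ model (u j) (v j))
      ≡⟨ ℤ-agree.sum-agree-off-two (λ k → H (u k) (v k)) (λ k → model (u k) (v k)) i j distinct
           (λ k k≢i k≢j → H-on-signs (proj₁ (signs-off k k≢i k≢j)) (proj₂ (signs-off k k≢i k≢j))) ⟩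
    Σℤ.sum (λ k → model (u k) (v k)) ℤ.+ (H (u i) (v i) ℤ.+ H (u j) (v j))
      ≡⟨ cong (ℤ._+ (H (u i) (v i) ℤ.+ H (u j) (v j)))
              (sym (Σℤ.*-distribˡ-sum (+ 8) (λ k → discord (u k) (v k)))) ⟩
    + 8 ℤ.* S ℤ.+ (H (u i) (v i) ℤ.+ H (u j) (v j)) ∎

regular-conference-symmetric : ∀ {n} (P : ℕ) (C : Fin n → Fin n → ℤ) →
  IsRegularConference n C → n ℕ.∸ 1 ≡ 4 ℕ.* P ℕ.+ 1 → ∀ i j → C i j ≡ C j i
regular-conference-symmetric P C conf n∸1≡ i j with i ≟ j
... | yes refl = refl
... | no i≢j   = rowPair-symmetric P (rowPair conf i≢j) n∸1≡

sum-const : ∀ n c → Σℚ.sum {n} (λ _ → c) ≡ ι (+ n) ℚ.* c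
sum-const ℕ.zero    c = sym (ℚP.*-zeroˡ c)
sum-const (ℕ.suc n) c = begin
  c ℚ.+ Σℚ.sum {n} (λ _ → c)  ≡⟨ cong (c ℚ.+_) (sum-const n c) ⟩
  c ℚ.+ ι (+ n) ℚ.* c         ≡⟨ factor c (ι (+ n)) ⟩
  (1ℚ ℚ.+ ι (+ n)) ℚ.* c      ≡⟨ cong (ℚ._* c) (sym (ι-+ (+ 1) (+ n))) ⟩
  ι (+ ℕ.suc n) ℚ.* c         ∎
  where
  open ≡-Reasoning
  factor : ∀ c m → c ℚ.+ m ℚ.* c ≡ (1ℚ ℚ.+ m) ℚ.* c
  factor c m = solve (c ∷ m ∷ []) ℚ-ring

sum-neg : ∀ {n} (f : Fin n → ℚ) → Σℚ.sum (λ k → ℚ.- f k) ≡ ℚ.- Σℚ.sum f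
sum-neg {ℕ.zero}  f = refl
sum-neg {ℕ.suc n} f = trans (cong (ℚ.- f zero ℚ.+_) (sum-neg (λ k → f (suc k))))
                            (sym (ℚP.neg-distrib-+ (f zero) (Σℚ.sum (λ k → f (suc k)))))

sum-sub : ∀ {n} (f g : Fin n → ℚ) → Σℚ.sum (λ k → f k ℚ.- g k) ≡ Σℚ.sum f ℚ.- Σℚ.sum g
sum-sub f g = trans (Σℚ.∑-distrib-+ f (λ k → ℚ.- g k)) (cong (Σℚ.sum f ℚ.+_) (sum-neg g))

-- Identities in ℚ(√−D).  The ring solver needs each component stated as an
-- explicit polynomial, hence the typed real and imaginary parts below.

product-polynomial : (D a b e d : ℚ) → Ext
product-polynomial D a b e d =
  ⟨ a ℚ.* a ℚ.+ D ℚ.* (b ℚ.* b) ℚ.* (e ℚ.* d) , a ℚ.* b ℚ.* (e ℚ.- d) ⟩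

product-formula : ∀ D a b e d →
  mulₑ D ⟨ a , e ℚ.* b ⟩ (conjₑ ⟨ a , d ℚ.* b ⟩) ≡ product-polynomial D a b e d
product-formula D a b e d = cong₂ ⟨_,_⟩ real-part imaginary-part
  where
  real-part : a ℚ.* a ℚ.- D ℚ.* ((e ℚ.* b) ℚ.* ℚ.- (d ℚ.* b))
            ≡ a ℚ.* a ℚ.+ D ℚ.* (b ℚ.* b) ℚ.* (e ℚ.* d)
  real-part = solve (D ∷ a ∷ b ∷ e ∷ d ∷ []) ℚ-ring
  imaginary-part : a ℚ.* ℚ.- (d ℚ.* b) ℚ.+ (e ℚ.* b) ℚ.* a ≡ a ℚ.* b ℚ.* (e ℚ.- d)
  imaginary-part = solve (a ∷ b ∷ e ∷ d ∷ []) ℚ-ring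

product-polynomial-exceptional : ∀ D a b e →
  product-polynomial D a b 0ℚ e +ₑ product-polynomial D a b e 0ℚ ≡ ⟨ a ℚ.* a ℚ.+ a ℚ.* a , 0ℚ ⟩
product-polynomial-exceptional D a b e = cong₂ ⟨_,_⟩ real-part imaginary-part
  where
  real-part : (a ℚ.* a ℚ.+ D ℚ.* (b ℚ.* b) ℚ.* (0ℚ ℚ.* e)) ℚ.+ (a ℚ.* a ℚ.+ D ℚ.* (b ℚ.* b) ℚ.* (e ℚ.* 0ℚ))
            ≡ a ℚ.* a ℚ.+ a ℚ.* a
  real-part = solve (D ∷ a ∷ b ∷ e ∷ []) ℚ-ring
  imaginary-part : a ℚ.* b ℚ.* (0ℚ ℚ.- e) ℚ.+ a ℚ.* b ℚ.* (e ℚ.- 0ℚ) ≡ 0ℚ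
  imaginary-part = solve (a ∷ b ∷ e ∷ []) ℚ-ring

unit-product-exceptional : ∀ D a c →
  mulₑ D 1ₑ (conjₑ ⟨ a , c ⟩) +ₑ mulₑ D ⟨ a , c ⟩ (conjₑ 1ₑ) ≡ ⟨ a ℚ.+ a , 0ℚ ⟩
unit-product-exceptional D a c = cong₂ ⟨_,_⟩ real-part imaginary-part
  where
  real-part : (1ℚ ℚ.* a ℚ.- D ℚ.* (0ℚ ℚ.* ℚ.- c)) ℚ.+ (a ℚ.* 1ℚ ℚ.- D ℚ.* (c ℚ.* ℚ.- 0ℚ))
            ≡ a ℚ.+ a
  real-part = solve (D ∷ a ∷ c ∷ []) ℚ-ring
  imaginary-part : (1ℚ ℚ.* ℚ.- c ℚ.+ 0ℚ ℚ.* a) ℚ.+ (a ℚ.* ℚ.- 0ℚ ℚ.+ c ℚ.* 1ℚ) ≡ 0ℚ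
  imaginary-part = solve (a ∷ c ∷ []) ℚ-ring

norm-one : ∀ D → mulₑ D 1ₑ (conjₑ 1ₑ) ≡ 1ₑ
norm-one D = cong ⟨_, 0ℚ ⟩ real-part
  where
  real-part : 1ℚ ℚ.* 1ℚ ℚ.- D ℚ.* (0ℚ ℚ.* ℚ.- 0ℚ) ≡ 1ℚ
  real-part = solve (D ∷ []) ℚ-ring

norm-conj : ∀ D a b →
  mulₑ D (conjₑ ⟨ a , b ⟩) (conjₑ (conjₑ ⟨ a , b ⟩)) ≡ mulₑ D ⟨ a , b ⟩ (conjₑ ⟨ a , b ⟩)
norm-conj D a b = cong₂ ⟨_,_⟩ real-part imaginary-part
  where
  real-part : a ℚ.* a ℚ.- D ℚ.* (ℚ.- b ℚ.* ℚ.- ℚ.- b) ≡ a ℚ.* a ℚ.- D ℚ.* (b ℚ.* ℚ.- b)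
  real-part = solve (D ∷ a ∷ b ∷ []) ℚ-ring
  imaginary-part : a ℚ.* ℚ.- ℚ.- b ℚ.+ ℚ.- b ℚ.* a ≡ a ℚ.* ℚ.- b ℚ.+ b ℚ.* a
  imaginary-part = solve (a ∷ b ∷ []) ℚ-ring

at-exceptional : ∀ {p q r s : ℤ} (F : ℤ → ℤ → Ext) → p ≡ + 0 → s ≡ + 0 → r ≡ q →
  F p q +ₑ F r s ≡ F (+ 0) q +ₑ F q (+ 0)
at-exceptional F refl refl refl = refl

module Entries (D : ℚ) (x : Ext) where

  a b : ℚ
  a = re x
  b = im x

  w : ℤ → Ext
  w = replace x

  T : ℤ → ℤ → Ext
  T u v = mulₑ D (w u) (conjₑ (w v))

  w-sign : ∀ {ε} → IsSign ε → w ε ≡ ⟨ a , ι ε ℚ.* b ⟩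
  w-sign (inj₁ refl) = cong ⟨ a ,_⟩ (sym (ℚP.*-identityˡ b))
  w-sign (inj₂ refl) = cong ⟨ a ,_⟩ minus-b
    where
    minus-b : ∀ {p} → ℚ.- p ≡ ι -[1+ 0 ] ℚ.* p
    minus-b {p} = solve (p ∷ []) ℚ-ring

  model : ℤ → ℤ → Ext
  model u v = product-polynomial D a b (ι u) (ι v)

  T-on-signs : ∀ {ε δ} → IsSign ε → IsSign δ → T ε δ ≡ model ε δ
  T-on-signs {ε} {δ} sε sδ = trans (cong₂ (λ p q → mulₑ D p (conjₑ q)) (w-sign sε) (w-sign sδ))
                                   (product-formula D a b (ι ε) (ι δ))

  T-diagonal : mulₑ D x (conjₑ x) ≡ 1ₑ → ∀ {z} → z ≡ + 0 ⊎ IsSign z → T z z ≡ 1ₑ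
  T-diagonal _    (inj₁ refl)        = norm-one D
  T-diagonal unit (inj₂ (inj₁ refl)) = unit
  T-diagonal unit (inj₂ (inj₂ refl)) = trans (norm-conj D a b) unit

  model-sum : ∀ {n} {u v : Fin n → ℤ} {i j} → RowPair u v i j →
    Σₑ.sum (λ k → model (u k) (v k)) ≡ ⟨ ι (+ n) ℚ.* (a ℚ.* a) , 0ℚ ⟩
  model-sum {n} {u} {v} rows =
    trans (sum-components (λ k → model (u k) (v k))) (cong₂ ⟨_,_⟩ real-part imaginary-part)
    where
    open RowPair rows
    open ≡-Reasoning
    Db² ab : ℚ
    Db² = D ℚ.* (b ℚ.* b)
    ab  = a ℚ.* b
    real-part : Σℚ.sum (λ k → a ℚ.* a ℚ.+ Db² ℚ.* (ι (u k) ℚ.* ι (v k))) ≡ ι (+ n) ℚ.* (a ℚ.* a)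
    real-part = begin
      Σℚ.sum (λ k → a ℚ.* a ℚ.+ Db² ℚ.* (ι (u k) ℚ.* ι (v k)))
        ≡⟨ Σℚ.∑-distrib-+ (λ (_ : Fin n) → a ℚ.* a) (λ k → Db² ℚ.* (ι (u k) ℚ.* ι (v k))) ⟩
      Σℚ.sum {n} (λ _ → a ℚ.* a) ℚ.+ Σℚ.sum (λ k → Db² ℚ.* (ι (u k) ℚ.* ι (v k)))
        ≡⟨ cong₂ ℚ._+_ (sum-const n (a ℚ.* a)) (sym (Σℚ.*-distribˡ-sum Db² (λ k → ι (u k) ℚ.* ι (v k)))) ⟩
      ι (+ n) ℚ.* (a ℚ.* a) ℚ.+ Db² ℚ.* Σℚ.sum (λ k → ι (u k) ℚ.* ι (v k))
        ≡⟨ cong (λ t → ι (+ n) ℚ.* (a ℚ.* a) ℚ.+ Db² ℚ.* t) orthogonal-in-ℚ ⟩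
      ι (+ n) ℚ.* (a ℚ.* a) ℚ.+ Db² ℚ.* 0ℚ
        ≡⟨ cong (ι (+ n) ℚ.* (a ℚ.* a) ℚ.+_) (ℚP.*-zeroʳ Db²) ⟩
      ι (+ n) ℚ.* (a ℚ.* a) ℚ.+ 0ℚ
        ≡⟨ ℚP.+-identityʳ _ ⟩
      ι (+ n) ℚ.* (a ℚ.* a) ∎
      where
      orthogonal-in-ℚ : Σℚ.sum (λ k → ι (u k) ℚ.* ι (v k)) ≡ 0ℚ
      orthogonal-in-ℚ = trans (Σℚ.sum-cong-≋ (λ k → sym (ι-* (u k) (v k))))
                              (trans (ι-sum (λ k → u k ℤ.* v k)) (cong ι orthogonal))
    imaginary-part : Σℚ.sum (λ k → ab ℚ.* (ι (u k) ℚ.- ι (v k))) ≡ 0ℚ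
    imaginary-part = begin
      Σℚ.sum (λ k → ab ℚ.* (ι (u k) ℚ.- ι (v k)))
        ≡⟨ sym (Σℚ.*-distribˡ-sum ab (λ k → ι (u k) ℚ.- ι (v k))) ⟩
      ab ℚ.* Σℚ.sum (λ k → ι (u k) ℚ.- ι (v k))
        ≡⟨ cong (ab ℚ.*_) (sum-sub (λ k → ι (u k)) (λ k → ι (v k))) ⟩
      ab ℚ.* (Σℚ.sum (λ k → ι (u k)) ℚ.- Σℚ.sum (λ k → ι (v k)))
        ≡⟨ cong₂ (λ s t → ab ℚ.* (s ℚ.- t)) (trans (ι-sum u) (cong ι u-sum))
                                              (trans (ι-sum v) (cong ι v-sum)) ⟩
      ab ℚ.* (ι rowSum ℚ.- ι rowSum)
        ≡⟨ cong (ab ℚ.*_) (ℚP.+-inverseʳ (ι rowSum)) ⟩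
      ab ℚ.* 0ℚ
        ≡⟨ ℚP.*-zeroʳ ab ⟩
      0ℚ ∎

  -- Off i and j the products follow
  -- the model; at i and j they contribute 2a instead of the model's 2a².
  rows-orthogonal : ∀ {n} {u v : Fin n → ℤ} {i j} → RowPair u v i j → u j ≡ v i →
    ι (+ n) ℚ.* (a ℚ.* a) ℚ.+ (a ℚ.+ a) ≡ a ℚ.* a ℚ.+ a ℚ.* a →
    sumₑ (λ k → T (u k) (v k)) ≡ 0ₑ
  rows-orthogonal {n} {u} {v} {i} {j} rows symmetric real-condition =
    +ₑ-cancelʳ _ 0ₑ 2a² (begin
      sumₑ (λ k → T (u k) (v k)) +ₑ 2a²
        ≡⟨ cong₂ _+ₑ_ (sumₑ≡sum (λ k → T (u k) (v k))) (sym model-exceptional) ⟩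
      Σₑ.sum (λ k → T (u k) (v k)) +ₑ (model (u i) (v i) +ₑ model (u j) (v j))
        ≡⟨ Ext-agree.sum-agree-off-two (λ k → T (u k) (v k)) (λ k → model (u k) (v k)) i j distinct
             (λ k k≢i k≢j → T-on-signs (proj₁ (signs-off k k≢i k≢j)) (proj₂ (signs-off k k≢i k≢j))) ⟩
      Σₑ.sum (λ k → model (u k) (v k)) +ₑ (T (u i) (v i) +ₑ T (u j) (v j))
        ≡⟨ cong₂ _+ₑ_ (model-sum rows) T-exceptional ⟩
      ⟨ ι (+ n) ℚ.* (a ℚ.* a) , 0ℚ ⟩ +ₑ ⟨ a ℚ.+ a , 0ℚ ⟩
        ≡⟨ cong ⟨_, 0ℚ ⟩ real-condition ⟩
      2a²
        ≡⟨ sym (CommutativeMonoid.identityˡ +ₑ-commutativeMonoid 2a²) ⟩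
      0ₑ +ₑ 2a² ∎)
    where
    open RowPair rows
    open ≡-Reasoning
    2a² : Ext
    2a² = ⟨ a ℚ.* a ℚ.+ a ℚ.* a , 0ℚ ⟩
    model-exceptional : model (u i) (v i) +ₑ model (u j) (v j) ≡ 2a²
    model-exceptional = trans (at-exceptional model u-diagonal v-diagonal symmetric)
                              (product-polynomial-exceptional D a b (ι (v i)))
    T-exceptional : T (u i) (v i) +ₑ T (u j) (v j) ≡ ⟨ a ℚ.+ a , 0ℚ ⟩
    T-exceptional = begin
      T (u i) (v i) +ₑ T (u j) (v j)
        ≡⟨ at-exceptional T u-diagonal v-diagonal symmetric ⟩
      mulₑ D 1ₑ (conjₑ (w (v i))) +ₑ mulₑ D (w (v i)) (conjₑ 1ₑ)
        ≡⟨ cong (λ y → mulₑ D 1ₑ (conjₑ y) +ₑ mulₑ D y (conjₑ 1ₑ)) (w-sign (v-sign i distinct)) ⟩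
      mulₑ D 1ₑ (conjₑ ⟨ a , ι (v i) ℚ.* b ⟩) +ₑ mulₑ D ⟨ a , ι (v i) ℚ.* b ⟩ (conjₑ 1ₑ)
        ≡⟨ unit-product-exceptional D a (ι (v i) ℚ.* b) ⟩
      ⟨ a ℚ.+ a , 0ℚ ⟩ ∎

conference⇒complex-hadamard : ∀ {n} (D : ℚ) (x : Ext) (C : Fin n → Fin n → ℤ) →
  IsRegularConference n C → (∀ i j → C i j ≡ C j i) →
  mulₑ D x (conjₑ x) ≡ 1ₑ →
  ι (+ n) ℚ.* (re x ℚ.* re x) ℚ.+ (re x ℚ.+ re x) ≡ re x ℚ.* re x ℚ.+ re x ℚ.* re x →
  IsComplexHadamard D n (λ i j → replace x (C i j))
conference⇒complex-hadamard D x C conf symmetric unit real-condition =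
  unit-entries , (λ i → sumₑ-ones _ (unit-entries i)) , orthogonal-rows
  where
  open Entries D x
  entry-kind : ∀ i j → C i j ≡ + 0 ⊎ IsSign (C i j)
  entry-kind i j with i ≟ j
  ... | yes refl = inj₁ (proj₁ (proj₁ conf) i)
  ... | no i≢j   = inj₂ (proj₁ (proj₂ (proj₁ conf)) i j i≢j)
  unit-entries : ∀ i j → T (C i j) (C i j) ≡ 1ₑ
  unit-entries i j = T-diagonal unit (entry-kind i j)
  orthogonal-rows : ∀ i j → i ≢ j → sumₑ (λ k → T (C i k) (C j k)) ≡ 0ₑ
  orthogonal-rows i j i≢j = rows-orthogonal (rowPair conf i≢j) (symmetric i j) real-condition

unit-modulus : ∀ D M q b → D ℚ.+ 1ℚ ≡ M ℚ.* M → M ℚ.* q ≡ 1ℚ → b ℚ.* b ≡ q ℚ.* q →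
  mulₑ D ⟨ ℚ.- q , b ⟩ (conjₑ ⟨ ℚ.- q , b ⟩) ≡ 1ₑ
unit-modulus D M q b D+1≡M² Mq≡1 b²≡q² = cong₂ ⟨_,_⟩ real-part imaginary-part
  where
  open ≡-Reasoning
  imaginary-part : ℚ.- q ℚ.* ℚ.- b ℚ.+ b ℚ.* ℚ.- q ≡ 0ℚ
  imaginary-part = solve (q ∷ b ∷ []) ℚ-ring
  real-part : ℚ.- q ℚ.* ℚ.- q ℚ.- D ℚ.* (b ℚ.* ℚ.- b) ≡ 1ℚ
  real-part = begin
    ℚ.- q ℚ.* ℚ.- q ℚ.- D ℚ.* (b ℚ.* ℚ.- b) ≡⟨ solve (q ∷ D ∷ b ∷ []) ℚ-ring ⟩
    q ℚ.* q ℚ.+ D ℚ.* (b ℚ.* b)           ≡⟨ cong (λ t → q ℚ.* q ℚ.+ D ℚ.* t) b²≡q² ⟩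
    q ℚ.* q ℚ.+ D ℚ.* (q ℚ.* q)           ≡⟨ solve (q ∷ D ∷ []) ℚ-ring ⟩
    (D ℚ.+ 1ℚ) ℚ.* (q ℚ.* q)              ≡⟨ cong (ℚ._* (q ℚ.* q)) D+1≡M² ⟩
    (M ℚ.* M) ℚ.* (q ℚ.* q)               ≡⟨ solve (M ∷ q ∷ []) ℚ-ring ⟩
    (M ℚ.* q) ℚ.* (M ℚ.* q)               ≡⟨ cong₂ ℚ._*_ Mq≡1 Mq≡1 ⟩
    1ℚ ℚ.* 1ℚ                             ≡⟨⟩
    1ℚ ∎

real-part-condition : ∀ N M q → N ≡ (M ℚ.+ M) ℚ.+ ι (+ 2) → M ℚ.* q ≡ 1ℚ →
  N ℚ.* (ℚ.- q ℚ.* ℚ.- q) ℚ.+ (ℚ.- q ℚ.+ ℚ.- q) ≡ ℚ.- q ℚ.* ℚ.- q ℚ.+ ℚ.- q ℚ.* ℚ.- q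
real-part-condition N M q N≡ Mq≡1 = begin
  N ℚ.* (ℚ.- q ℚ.* ℚ.- q) ℚ.+ (ℚ.- q ℚ.+ ℚ.- q)
    ≡⟨ cong (λ t → t ℚ.* (ℚ.- q ℚ.* ℚ.- q) ℚ.+ (ℚ.- q ℚ.+ ℚ.- q)) N≡ ⟩
  ((M ℚ.+ M) ℚ.+ ι (+ 2)) ℚ.* (ℚ.- q ℚ.* ℚ.- q) ℚ.+ (ℚ.- q ℚ.+ ℚ.- q)
    ≡⟨ solve (M ∷ q ∷ []) ℚ-ring ⟩
  (M ℚ.* q) ℚ.* (q ℚ.+ q) ℚ.+ ((ℚ.- q ℚ.* ℚ.- q ℚ.+ ℚ.- q ℚ.* ℚ.- q) ℚ.- (q ℚ.+ q))
    ≡⟨ cong (λ t → t ℚ.* (q ℚ.+ q) ℚ.+ ((ℚ.- q ℚ.* ℚ.- q ℚ.+ ℚ.- q ℚ.* ℚ.- q) ℚ.- (q ℚ.+ q))) Mq≡1 ⟩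
  1ℚ ℚ.* (q ℚ.+ q) ℚ.+ ((ℚ.- q ℚ.* ℚ.- q ℚ.+ ℚ.- q ℚ.* ℚ.- q) ℚ.- (q ℚ.+ q))
    ≡⟨ solve (q ∷ []) ℚ-ring ⟩
  ℚ.- q ℚ.* ℚ.- q ℚ.+ ℚ.- q ℚ.* ℚ.- q ∎
  where open ≡-Reasoning

order-minus-one : ∀ θ → confSize θ ℕ.∸ 1 ≡ 4 ℕ.* (θ ℕ.* ℕ.suc θ) ℕ.+ 1
order-minus-one θ = begin
  confSize θ ℕ.∸ 1                                ≡⟨ cong (ℕ._∸ 1) (size θ) ⟩
  (4 ℕ.* (θ ℕ.* ℕ.suc θ) ℕ.+ 1) ℕ.+ 1 ℕ.∸ 1       ≡⟨ ℕP.m+n∸n≡m _ 1 ⟩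
  4 ℕ.* (θ ℕ.* ℕ.suc θ) ℕ.+ 1                     ∎
  where
  open ≡-Reasoning
  size : ∀ θ → 4 ℕ.* θ ℕ.* θ ℕ.+ 4 ℕ.* θ ℕ.+ 2 ≡ (4 ℕ.* (θ ℕ.* ℕ.suc θ) ℕ.+ 1) ℕ.+ 1
  size = solve-∀

-- The parameters of the corollary for θ = t + 1, in terms of
-- m = 2θ(θ+1), M = ι m and q = 1/m: x = −q ± q·i√D, D + 1 = M², n = 2M + 2.
module Parameters (t : ℕ) where

  θ m : ℕ
  θ = ℕ.suc t
  m = 2 ℕ.* θ ℕ.* ℕ.suc θ

  M q : ℚ
  M = ι (+ m)
  q = + 1 / m

  Mq≡1 : M ℚ.* q ≡ 1ℚ
  Mq≡1 = ι-inverse (ℕ.pred m)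

  D+1≡M² : Dθ θ ℚ.+ 1ℚ ≡ M ℚ.* M
  D+1≡M² = begin
    ι (+ (4 ℕ.* θ ℕ.* θ ℕ.* (θ ℕ.+ 1) ℕ.* (θ ℕ.+ 1) ℕ.∸ 1)) ℚ.+ ι (+ 1)
      ≡⟨ cong (λ k → ι (+ (k ℕ.∸ 1)) ℚ.+ ι (+ 1)) (square θ) ⟩
    ι (+ (m ℕ.* m ℕ.∸ 1)) ℚ.+ ι (+ 1)  ≡⟨ sym (ι-+ (+ (m ℕ.* m ℕ.∸ 1)) (+ 1)) ⟩
    ι (+ (m ℕ.* m ℕ.∸ 1 ℕ.+ 1))        ≡⟨ cong (λ k → ι (+ k)) (ℕP.m∸n+n≡m {m ℕ.* m} (ℕ.s≤s ℕ.z≤n)) ⟩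
    ι (+ (m ℕ.* m))                     ≡⟨ cong ι (ℤP.pos-* m m) ⟩
    ι (+ m ℤ.* + m)                     ≡⟨ ι-* (+ m) (+ m) ⟩
    M ℚ.* M                             ∎
    where
    open ≡-Reasoning
    square : ∀ θ → 4 ℕ.* θ ℕ.* θ ℕ.* (θ ℕ.+ 1) ℕ.* (θ ℕ.+ 1)
                 ≡ (2 ℕ.* θ ℕ.* ℕ.suc θ) ℕ.* (2 ℕ.* θ ℕ.* ℕ.suc θ)
    square = solve-∀

  n≡2M+2 : ι (+ confSize θ) ≡ (M ℚ.+ M) ℚ.+ ι (+ 2)
  n≡2M+2 = begin
    ι (+ confSize θ)             ≡⟨ cong (λ k → ι (+ k)) (size θ) ⟩
    ι ((+ m ℤ.+ + m) ℤ.+ + 2)    ≡⟨ ι-+ (+ m ℤ.+ + m) (+ 2) ⟩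
    ι (+ m ℤ.+ + m) ℚ.+ ι (+ 2)  ≡⟨ cong (ℚ._+ ι (+ 2)) (ι-+ (+ m) (+ m)) ⟩
    (M ℚ.+ M) ℚ.+ ι (+ 2)        ∎
    where
    open ≡-Reasoning
    size : ∀ θ → 4 ℕ.* θ ℕ.* θ ℕ.+ 4 ℕ.* θ ℕ.+ 2
               ≡ (2 ℕ.* θ ℕ.* ℕ.suc θ ℕ.+ 2 ℕ.* θ ℕ.* ℕ.suc θ) ℕ.+ 2
    size = solve-∀

  x-unit : ∀ s → mulₑ (Dθ θ) (xθ θ s) (conjₑ (xθ θ s)) ≡ 1ₑ
  x-unit true  = unit-modulus (Dθ θ) M q q D+1≡M² Mq≡1 refl
  x-unit false = unit-modulus (Dθ θ) M q (ℚ.- q) D+1≡M² Mq≡1 (neg-square q)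
    where
    neg-square : ∀ q → ℚ.- q ℚ.* ℚ.- q ≡ q ℚ.* q
    neg-square q = solve (q ∷ []) ℚ-ring

  x-real-part : ∀ s → let a = re (xθ θ s) in
    ι (+ confSize θ) ℚ.* (a ℚ.* a) ℚ.+ (a ℚ.+ a) ≡ a ℚ.* a ℚ.+ a ℚ.* a
  x-real-part true  = real-part-condition (ι (+ confSize θ)) M q n≡2M+2 Mq≡1
  x-real-part false = real-part-condition (ι (+ confSize θ)) M q n≡2M+2 Mq≡1

corollary2p6 : (θ : ℕ) → 0 < θ →
    (C : Fin (confSize θ) → Fin (confSize θ) → ℤ) →
    IsRegularConference (confSize θ) C →
    (s : Bool) →
    IsComplexHadamard (Dθ θ) (confSize θ) (λ i j → replace (xθ θ s) (C i j))
corollary2p6 ℕ.zero    ()  C conf s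
corollary2p6 (ℕ.suc t) _   C conf s =
  conference⇒complex-hadamard (Dθ θ) (xθ θ s) C conf
    (regular-conference-symmetric (θ ℕ.* ℕ.suc θ) C conf (order-minus-one θ))
    (x-unit s) (x-real-part s)
  where open Parameters t
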